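{- For the path $P_n$ on $n$ vertices with the standard price function ($P\equiv 2$), and for every integer $t\ge 1$, the ratio $\pi^{t+1}(P_n)/\pi^{t}(P_n)$ does not depend on $n$ for $n\ge t+1$, and equals \[ \frac{2^{t+1}-1}{2(2^{t}-1)}. \]
   Context: A configuration of $k$ pebbles on a graph $G$ is a function $C:V(G)\to\mathbb{Z}_{\ge0}$ with total sum $k$. A pebbling move along an edge $uv$ removes two pebbles from $u$ and adds one pebble to $v$ (allowed only if $u$ has at least two pebbles). A configuration is $t$-solvable if for every set of $t$ vertices some sequence of pebbling moves yields a configuration with at least one pebble on each of those $t$ vertices. $\pi^t(G)$ is the minimum $k$ such that every configuration of $k$ pebbles on $G$ is $t$-solvable (defined for $1\le t\le |V(G)|$). In the paper this statement is phrased as: the pebbling ratio sequence $\alpha^t(\mathcal{P})=(\pi^{t+1}(P_n)/\pi^t(P_n))_n$ of the family of paths is constant. -}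

module Defs where

open import Data.Nat using (ℕ; zero; suc; _+_; _*_; _∸_; _^_; _≤_; _<_)
open import Data.Fin using (Fin; toℕ)
open import Data.Fin.Subset using (Subset; _∈_; ∣_∣)
open import Data.Vec.Functional using (foldr)
open import Data.Product using (Σ; ∃; ∃-syntax; _×_)
open import Data.Sum using (_⊎_)
open import Relation.Binary.PropositionalEquality using (_≡_; _≢_)
open import Relation.Binary.Construct.Closure.ReflexiveTransitive using (Star)
open import Relation.Nullary using (¬_)

Config : ℕ → Set
Config n = Fin n → ℕ

size : ∀ {n} → Config n → ℕ
size = foldr _+_ 0

PathAdj : ∀ {n} → Fin n → Fin n → Set
PathAdj u v = (toℕ v ≡ suc (toℕ u)) ⊎ (toℕ u ≡ suc (toℕ v))

Move : ∀ {n} → Config n → Config n → Set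
Move {n} C C′ = ∃[ u ] ∃[ v ]
  ( PathAdj u v
  × 2 ≤ C u
  × C′ u ≡ C u ∸ 2
  × C′ v ≡ suc (C v)
  × (∀ w → w ≢ u → w ≢ v → C′ w ≡ C w))

Reach : ∀ {n} → Config n → Config n → Set
Reach = Star Move

Solvable : ∀ {n} → ℕ → Config n → Set
Solvable {n} t C = (S : Subset n) → ∣ S ∣ ≡ t →
  ∃[ C′ ] (Reach C C′ × (∀ v → v ∈ S → 1 ≤ C′ v))

AllSolvable : ℕ → ℕ → ℕ → Set
AllSolvable n t k = (C : Config n) → size C ≡ k → Solvable t C

IsPebblingNumber : ℕ → ℕ → ℕ → Set
IsPebblingNumber n t k = AllSolvable n t k × (∀ k′ → k′ < k → ¬ AllSolvable n t k′)

{-# OPTIONS --safe #-}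
-- π^t(P_n) = 2^(n-1) + 2^(n-2) + ⋯ + 2^(n-t) = (2^t - 1) 2^(n-t), from which the ratio is read off.
--
-- Lower bound: give vertex i the weight 2^(n-1-i). A move towards vertex 0 keeps the total weight
-- and a move away from it lowers it, so k pebbles piled on vertex n-1 (weight k) can cover the
-- first t vertices (weight π n t) only if k ≥ π n t.
--
-- Upper bound: induction along the path, with a demand of D pebbles at vertex 0 and targets on
-- the remaining vertices. With a surplus at vertex 0, half of it is pushed to vertex 1 and the
-- shorter path covers the targets; with a deficit, the shorter path gathers twice the deficit
-- on vertex 1 (plus one if vertex 1 is a target) and sends it back.
module Submission where

open import Defs
open import Data.Nat using (ℕ; zero; suc; _+_; _*_; _∸_; _^_; _≤_; _<_; z≤n; s≤s; _≤?_; >-nonZero)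
open import Data.Nat.Properties
open import Data.Nat.DivMod using (_/_; m/n*n≤m; /-monoˡ-≤; m*n/n≡m; +-distrib-/-∣ʳ)
open import Data.Nat.Divisibility using (divides-refl)
open import Data.Nat.Tactic.RingSolver using (solve-∀)
open import Data.Fin using (zero; suc)
import Data.Fin.Properties as Finₚ
open import Data.Fin.Subset using (Subset; Side; inside; outside; _∈_; ∣_∣)
open import Data.Fin.Subset.Properties using (∣p∣≤n; ∣p∣≤∣x∷p∣)
open import Data.Vec using ([]; _∷_; lookup; here; there)
open import Data.Vec.Functional using (head; tail) renaming ([] to []ᶠ; _∷_ to infixr 5 _∷ᶠ_)
open import Data.Product using (∃-syntax; _×_; _,_)
open import Data.Sum using (inj₁; inj₂)
import Data.Sum as Sum
open import Function using (_∘_)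
open import Relation.Nullary using (¬_; yes; no; contradiction)
open import Relation.Binary.PropositionalEquality
open import Relation.Binary.Construct.Closure.ReflexiveTransitive using (ε; _◅_; _◅◅_; gmap)

π : ℕ → ℕ → ℕ
π zero    t       = 0
π (suc n) zero    = 0
π (suc n) (suc t) = 2 ^ n + π n t

π-zeroʳ : ∀ n → π n 0 ≡ 0
π-zeroʳ zero    = refl
π-zeroʳ (suc n) = refl

π<2^n : ∀ n t → π n t < 2 ^ n
π<2^n zero    t       = s≤s z≤n
π<2^n (suc n) zero    = m^n>0 2 (suc n)
π<2^n (suc n) (suc t) = +-monoʳ-< (2 ^ n) (≤-trans (π<2^n n t) (m≤m+n (2 ^ n) 0))

π-monoˡ-≤ : ∀ n t → π n t ≤ π (suc n) t
π-monoˡ-≤ zero    t       = z≤n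
π-monoˡ-≤ (suc n) zero    = z≤n
π-monoˡ-≤ (suc n) (suc t) = +-mono-≤ (m≤n*m (2 ^ n) 2) (π-monoˡ-≤ n t)

π-monoʳ-≤ : ∀ n {t u} → t ≤ u → π n t ≤ π n u
π-monoʳ-≤ zero    _         = z≤n
π-monoʳ-≤ (suc n) z≤n       = z≤n
π-monoʳ-≤ (suc n) (s≤s t≤u) = +-monoʳ-≤ (2 ^ n) (π-monoʳ-≤ n t≤u)

π-double : ∀ {t n} → t ≤ n → π (suc n) t ≡ 2 * π n t
π-double {n = zero}  z≤n       = refl
π-double {n = suc n} z≤n       = refl
π-double {suc t} {suc n} (s≤s t≤n) = begin
  2 * 2 ^ n + π (suc n) t   ≡⟨ cong (2 * 2 ^ n +_) (π-double t≤n) ⟩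
  2 * 2 ^ n + 2 * π n t     ≡⟨ *-distribˡ-+ 2 (2 ^ n) (π n t) ⟨
  2 * (2 ^ n + π n t)       ∎
  where open ≡-Reasoning

π-closed : ∀ t r → π (t + r) t + 2 ^ r ≡ 2 ^ (t + r)
π-closed zero    r = cong (_+ 2 ^ r) (π-zeroʳ r)
π-closed (suc t) r = begin
  2 ^ (t + r) + π (t + r) t + 2 ^ r     ≡⟨ +-assoc (2 ^ (t + r)) _ _ ⟩
  2 ^ (t + r) + (π (t + r) t + 2 ^ r)   ≡⟨ cong (2 ^ (t + r) +_) (π-closed t r) ⟩
  2 ^ (t + r) + 2 ^ (t + r)             ≡⟨ cong (2 ^ (t + r) +_) (+-identityʳ _) ⟨
  2 ^ suc (t + r)                       ∎
  where open ≡-Reasoning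

π-closed-form : ∀ t r → π (t + r) t ≡ (2 ^ t ∸ 1) * 2 ^ r
π-closed-form t r = begin
  π (t + r) t                   ≡⟨ m+n∸n≡m _ (2 ^ r) ⟨
  π (t + r) t + 2 ^ r ∸ 2 ^ r   ≡⟨ cong (_∸ 2 ^ r) (π-closed t r) ⟩
  2 ^ (t + r) ∸ 2 ^ r           ≡⟨ cong₂ _∸_ (^-distribˡ-+-* 2 t r) (sym (*-identityˡ (2 ^ r))) ⟩
  2 ^ t * 2 ^ r ∸ 1 * 2 ^ r     ≡⟨ *-distribʳ-∸ (2 ^ r) (2 ^ t) 1 ⟨
  (2 ^ t ∸ 1) * 2 ^ r           ∎
  where open ≡-Reasoning

π-ratio : ∀ {t n} → suc t ≤ n → π n (suc t) * (2 * (2 ^ t ∸ 1)) ≡ π n t * (2 ^ suc t ∸ 1)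
π-ratio {t} t<n with m≤n⇒∃[o]m+o≡n t<n
... | r , refl = begin
  π (suc t + r) (suc t) * (2 * (2 ^ t ∸ 1))
    ≡⟨ cong (_* (2 * (2 ^ t ∸ 1))) (π-closed-form (suc t) r) ⟩
  (2 ^ suc t ∸ 1) * 2 ^ r * (2 * (2 ^ t ∸ 1))
    ≡⟨ rearrange (2 ^ suc t ∸ 1) (2 ^ t ∸ 1) (2 ^ r) ⟩
  (2 ^ t ∸ 1) * 2 ^ suc r * (2 ^ suc t ∸ 1)
    ≡⟨ cong (_* (2 ^ suc t ∸ 1)) (π-closed-form t (suc r)) ⟨
  π (t + suc r) t * (2 ^ suc t ∸ 1)
    ≡⟨ cong (λ n → π n t * (2 ^ suc t ∸ 1)) (+-suc t r) ⟩
  π (suc t + r) t * (2 ^ suc t ∸ 1)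
    ∎
  where
  open ≡-Reasoning
  rearrange : ∀ A B P → A * P * (2 * B) ≡ B * (2 * P) * A
  rearrange = solve-∀

Covers : ∀ {n} → Subset n → Config n → Set
Covers S C = ∀ v → v ∈ S → 1 ≤ C v

Reaches : ∀ {n} → Config n → (Config n → Set) → Set
Reaches C P = ∃[ C′ ] (Reach C C′ × P C′)

reaches-◅◅ : ∀ {n} {C C′ : Config n} {P : Config n → Set} →
  Reach C C′ → Reaches C′ P → Reaches C P
reaches-◅◅ r (C″ , r′ , p) = C″ , r ◅◅ r′ , p

-- Configurations are functions, so C and head C ∷ᶠ tail C agree only pointwise; reachability is
-- transported along ≗ instead.
move-respˡ : ∀ {n} {C₁ C₂ C′ : Config n} → C₁ ≗ C₂ → Move C₁ C′ → Move C₂ C′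
move-respˡ eq (u , v , adj , 2≤ , eu , ev , rest) =
  u , v , adj , subst (2 ≤_) (eq u) 2≤ , trans eu (cong (_∸ 2) (eq u)) ,
  trans ev (cong suc (eq v)) , λ w w≢u w≢v → trans (rest w w≢u w≢v) (eq w)

reaches-resp : ∀ {n} {P : Config n → Set} → (∀ {A B} → A ≗ B → P A → P B) →
  ∀ {C₁ C₂} → C₁ ≗ C₂ → Reaches C₁ P → Reaches C₂ P
reaches-resp resp eq (_  , ε     , p) = _ , ε , resp eq p
reaches-resp resp eq (C′ , m ◅ r , p) = C′ , move-respˡ eq m ◅ r , p

move-right : ∀ {n} a b (R : Config n) → Move (suc (suc a) ∷ᶠ b ∷ᶠ R) (a ∷ᶠ suc b ∷ᶠ R)
move-right a b R = zero , suc zero , inj₁ refl , s≤s (s≤s z≤n) , refl , refl , λ where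
  zero          w≢0 _   → contradiction refl w≢0
  (suc zero)    _   w≢1 → contradiction refl w≢1
  (suc (suc i)) _   _   → refl

move-left : ∀ {n} a b (R : Config n) → Move (a ∷ᶠ suc (suc b) ∷ᶠ R) (suc a ∷ᶠ b ∷ᶠ R)
move-left a b R = suc zero , zero , inj₂ refl , s≤s (s≤s z≤n) , refl , refl , λ where
  zero          _   w≢0 → contradiction refl w≢0
  (suc zero)    w≢1 _   → contradiction refl w≢1
  (suc (suc i)) _   _   → refl

push : ∀ {n} q a b (R : Config n) → Reach (q * 2 + a ∷ᶠ b ∷ᶠ R) (a ∷ᶠ q + b ∷ᶠ R)
push zero    a b R = ε
push (suc q) a b R =
  move-right (q * 2 + a) b R ◅
  subst (λ b′ → Reach (q * 2 + a ∷ᶠ suc b ∷ᶠ R) (a ∷ᶠ b′ ∷ᶠ R)) (+-suc q b) (push q a (suc b) R)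

pull : ∀ {n} q a b (R : Config n) → Reach (a ∷ᶠ q * 2 + b ∷ᶠ R) (q + a ∷ᶠ b ∷ᶠ R)
pull zero    a b R = ε
pull (suc q) a b R =
  move-left a (q * 2 + b) R ◅
  subst (λ a′ → Reach (suc a ∷ᶠ q * 2 + b ∷ᶠ R) (a′ ∷ᶠ b ∷ᶠ R)) (+-suc q a) (pull q (suc a) b R)

move-∷ : ∀ {n} a {T T′ : Config n} → Move T T′ → Move (a ∷ᶠ T) (a ∷ᶠ T′)
move-∷ a (u , v , adj , 2≤ , eu , ev , rest) =
  suc u , suc v , Sum.map (cong suc) (cong suc) adj , 2≤ , eu , ev , λ where
    zero    _   _   → refl
    (suc w) w≢u w≢v → rest w (w≢u ∘ cong suc) (w≢v ∘ cong suc)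

reach-∷ : ∀ {n} a {T T′ : Config n} → Reach T T′ → Reach (a ∷ᶠ T) (a ∷ᶠ T′)
reach-∷ a = gmap (a ∷ᶠ_) (move-∷ a)

demand : Side → ℕ
demand inside  = 1
demand outside = 0

covers-∷ : ∀ {m} x {S : Subset m} {C : Config (suc m)} →
  demand x ≤ head C → Covers S (tail C) → Covers (x ∷ S) C
covers-∷ x d cov zero    here        = d
covers-∷ x d cov (suc v) (there v∈S) = cov v v∈S

π-∷ : ∀ {k} x (S : Subset k) → demand x * 2 ^ k + π k ∣ S ∣ ≤ π (suc k) ∣ x ∷ S ∣
π-∷ {k} inside  S = ≤-reflexive (cong (_+ π k ∣ S ∣) (*-identityˡ (2 ^ k)))
π-∷ {k} outside S = π-monoˡ-≤ k ∣ S ∣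

RootedCover : ∀ {m} → ℕ → Subset m → Config (suc m) → Set
RootedCover D S C = D ≤ head C × Covers S (tail C)

rootedCover-resp : ∀ {m D} {S : Subset m} {A B : Config (suc m)} →
  A ≗ B → RootedCover D S A → RootedCover D S B
rootedCover-resp eq (d , cov) =
  subst (_ ≤_) (eq zero) d , λ v v∈S → subst (1 ≤_) (eq (suc v)) (cov v v∈S)

-- Vertex zero is a root that must receive D pebbles; S lives on the other m vertices. For D ≥ 1
-- the first bound implies the second, which is only needed for D = 0.
RootedSolvable : ℕ → Set
RootedSolvable m = ∀ D (S : Subset m) (C : Config (suc m)) →
  D * 2 ^ m + π m ∣ S ∣ ≤ size C → π (suc m) ∣ S ∣ ≤ size C → Reaches C (RootedCover D S)

cover-reachable : ∀ {k} → RootedSolvable k → (S : Subset (suc k)) (C : Config (suc k)) →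
  π (suc k) ∣ S ∣ ≤ size C → Reaches C (Covers S)
cover-reachable {k} solve (x ∷ S) C enough
  with solve (demand x) S C (≤-trans (π-∷ x S) enough)
             (≤-trans (π-monoʳ-≤ (suc k) (∣p∣≤∣x∷p∣ x S)) enough)
... | C′ , r , d , cov = C′ , r , covers-∷ x d cov

d*p+f≤o⇒d+2*f≤o : ∀ {D F P z} → F < P → D * P + F ≤ z → 2 * F ≤ z → D + 2 * F ≤ z
d*p+f≤o⇒d+2*f≤o {zero}          _   _ 2F≤z = 2F≤z
d*p+f≤o⇒d+2*f≤o {suc d} {F} {P} F<P h _    = ≤-trans (begin
  suc d + 2 * F      ≡⟨ rearrange d F ⟩
  suc F + d + F      ≤⟨ +-monoˡ-≤ F (+-mono-≤ F<P (m≤m*n d P {{>-nonZero (m<n⇒0<n F<P)}})) ⟩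
  P + d * P + F      ∎) h
  where
  open ≤-Reasoning
  rearrange : ∀ d F → suc d + 2 * F ≡ suc F + d + F
  rearrange = solve-∀

m+n≤o+p⇒n≤o∸m+p : ∀ {D c X y} → D ≤ c → D + X ≤ c + y → X ≤ (c ∸ D) + y
m+n≤o+p⇒n≤o∸m+p {D} {c} {X} {y} D≤c h = +-cancelˡ-≤ D X _ (begin
  D + X                ≤⟨ h ⟩
  c + y                ≡⟨ cong (_+ y) (m+[n∸m]≡n D≤c) ⟨
  D + (c ∸ D) + y      ≡⟨ +-assoc D (c ∸ D) y ⟩
  D + ((c ∸ D) + y)    ∎)
  where open ≤-Reasoning

2*m≤n+o⇒m≤n/2+o : ∀ {F} e y → 2 * F ≤ e + y → F ≤ e / 2 + y
2*m≤n+o⇒m≤n/2+o {F} e y 2F≤ = begin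
  F                    ≡⟨ m*n/n≡m F 2 ⟨
  F * 2 / 2            ≤⟨ /-monoˡ-≤ 2 (begin
                            F * 2     ≡⟨ *-comm F 2 ⟩
                            2 * F     ≤⟨ 2F≤ ⟩
                            e + y     ≤⟨ +-monoʳ-≤ e (m≤m*n y 2) ⟩
                            e + y * 2 ∎) ⟩
  (e + y * 2) / 2      ≡⟨ +-distrib-/-∣ʳ e (divides-refl y) ⟩
  e / 2 + y * 2 / 2    ≡⟨ cong (e / 2 +_) (m*n/n≡m y 2) ⟩
  e / 2 + y            ∎
  where open ≤-Reasoning

[m+n]*p+f≤m+o⇒n*p+f≤o : ∀ {c Q P F y} → 1 ≤ P → (c + Q) * P + F ≤ c + y → Q * P + F ≤ y
[m+n]*p+f≤m+o⇒n*p+f≤o {c} {Q} {P} {F} {y} 1≤P h = +-cancelˡ-≤ c _ y (begin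
  c + (Q * P + F)        ≤⟨ +-monoˡ-≤ _ (m≤m*n c P {{>-nonZero 1≤P}}) ⟩
  c * P + (Q * P + F)    ≡⟨ rearrange c Q P F ⟩
  (c + Q) * P + F        ≤⟨ h ⟩
  c + y                  ∎)
  where
  open ≤-Reasoning
  rearrange : ∀ c Q P F → c * P + (Q * P + F) ≡ (c + Q) * P + F
  rearrange = solve-∀

rooted-surplus : ∀ {k} → RootedSolvable k → ∀ D (S : Subset (suc k)) (C : Config (suc (suc k))) →
  D ≤ head C → D * 2 ^ suc k + π (suc k) ∣ S ∣ ≤ size C → π (suc (suc k)) ∣ S ∣ ≤ size C →
  Reaches C (RootedCover D S)
rooted-surplus {k} solve D S C D≤c h₁ h₂ =
  reaches-resp rootedCover-resp split (finish (cover-reachable solve S (q + b ∷ᶠ R) enough))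
  where
  c = head C
  b = C (suc zero)
  R = tail (tail C)
  F = π (suc k) ∣ S ∣
  q = (c ∸ D) / 2
  a = c ∸ q * 2

  2q≤c∸D : q * 2 ≤ c ∸ D
  2q≤c∸D = m/n*n≤m (c ∸ D) 2

  2F≤ : 2 * F ≤ (c ∸ D) + size (tail C)
  2F≤ = m+n≤o+p⇒n≤o∸m+p D≤c
          (d*p+f≤o⇒d+2*f≤o {D} (π<2^n (suc k) ∣ S ∣) h₁ (subst (_≤ size C) (π-double (∣p∣≤n S)) h₂))

  enough : F ≤ (q + b) + size R
  enough = ≤-trans (2*m≤n+o⇒m≤n/2+o (c ∸ D) _ 2F≤) (≤-reflexive (sym (+-assoc q b (size R))))

  split : (q * 2 + a ∷ᶠ b ∷ᶠ R) ≗ C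
  split zero          = m+[n∸m]≡n (≤-trans 2q≤c∸D (m∸n≤m c D))
  split (suc zero)    = refl
  split (suc (suc i)) = refl

  finish : Reaches (q + b ∷ᶠ R) (Covers S) → Reaches (q * 2 + a ∷ᶠ b ∷ᶠ R) (RootedCover D S)
  finish (T′ , r , cov) =
    a ∷ᶠ T′ , push q a b R ◅◅ reach-∷ a r , subst (_≤ a) (m∸[m∸n]≡n D≤c) (∸-monoʳ-≤ c 2q≤c∸D) , cov

rooted-deficit : ∀ {k} → RootedSolvable k → ∀ D x (S : Subset k) (C : Config (suc (suc k))) →
  head C < D → D * 2 ^ suc k + π (suc k) ∣ x ∷ S ∣ ≤ size C → Reaches C (RootedCover D (x ∷ S))
rooted-deficit {k} solve D x S C c<D h =
  reaches-resp rootedCover-resp split (finish (solve (demand x + Q * 2) S (tail C) h₁ h₂))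
  where
  c = head C
  Q = D ∸ c
  F = π (suc k) ∣ x ∷ S ∣

  enough : Q * 2 ^ suc k + F ≤ size (tail C)
  enough = [m+n]*p+f≤m+o⇒n*p+f≤o {c} {Q} (m^n>0 2 (suc k))
             (subst (λ D → D * 2 ^ suc k + F ≤ size C) (sym (m+[n∸m]≡n (<⇒≤ c<D))) h)

  h₁ : (demand x + Q * 2) * 2 ^ k + π k ∣ S ∣ ≤ size (tail C)
  h₁ = begin
    (demand x + Q * 2) * 2 ^ k + π k ∣ S ∣         ≡⟨ rearrange (demand x) Q (2 ^ k) (π k ∣ S ∣) ⟩
    Q * 2 ^ suc k + (demand x * 2 ^ k + π k ∣ S ∣) ≤⟨ +-monoʳ-≤ (Q * 2 ^ suc k) (π-∷ x S) ⟩
    Q * 2 ^ suc k + F                             ≤⟨ enough ⟩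
    size (tail C)                                 ∎
    where
    open ≤-Reasoning
    rearrange : ∀ i Q P X → (i + Q * 2) * P + X ≡ Q * (2 * P) + (i * P + X)
    rearrange = solve-∀

  h₂ : π (suc k) ∣ S ∣ ≤ size (tail C)
  h₂ = ≤-trans (π-monoʳ-≤ (suc k) (∣p∣≤∣x∷p∣ x S)) (≤-trans (m≤n+m F _) enough)

  split : (c ∷ᶠ tail C) ≗ C
  split zero    = refl
  split (suc i) = refl

  finish : Reaches (tail C) (RootedCover (demand x + Q * 2) S) →
           Reaches (c ∷ᶠ tail C) (RootedCover D (x ∷ S))
  finish (T′ , r , d , cov) = reaches-◅◅ (reach-∷ c r) (reaches-resp rootedCover-resp split′
    (Q + c ∷ᶠ b′ ∷ᶠ tail T′ , pull Q c b′ (tail T′) ,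
     ≤-reflexive (sym (m∸n+n≡m (<⇒≤ c<D))) , covers-∷ x (m+n≤o⇒m≤o∸n (demand x) d) cov))
    where
    b′ = head T′ ∸ Q * 2
    split′ : (c ∷ᶠ Q * 2 + b′ ∷ᶠ tail T′) ≗ (c ∷ᶠ T′)
    split′ zero          = refl
    split′ (suc zero)    = m+[n∸m]≡n (m+n≤o⇒n≤o (demand x) d)
    split′ (suc (suc i)) = refl

rootedSolvable : ∀ m → RootedSolvable m
rootedSolvable zero D [] C h₁ _ =
  C , ε , subst₂ _≤_ (trans (+-identityʳ _) (*-identityʳ D)) (+-identityʳ _) h₁ , λ _ ()
rootedSolvable (suc k) D (x ∷ S) C h₁ h₂ with D ≤? head C
... | yes D≤c = rooted-surplus (rootedSolvable k) D (x ∷ S) C D≤c h₁ h₂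
... | no  D≰c = rooted-deficit (rootedSolvable k) D x S C (≰⇒> D≰c) h₁

allSolvable-π : ∀ n t → AllSolvable n t (π n t)
allSolvable-π zero    t C _     [] _     = C , ε , λ _ ()
allSolvable-π (suc n) t C size≡ S ∣S∣≡t =
  cover-reachable (rootedSolvable n) S C (≤-reflexive (trans (cong (π (suc n)) ∣S∣≡t) (sym size≡)))

weight : ∀ {n} → Config n → ℕ
weight {zero}  C = 0
weight {suc n} C = head C * 2 ^ n + weight (tail C)

weight-cong : ∀ {n} {A B : Config n} → A ≗ B → weight A ≡ weight B
weight-cong {zero}  eq = refl
weight-cong {suc n} eq = cong₂ _+_ (cong (_* 2 ^ n) (eq zero)) (weight-cong (eq ∘ suc))

weight-mono : ∀ {n} {A B : Config n} → (∀ i → A i ≤ B i) → weight A ≤ weight B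
weight-mono {zero}  le = z≤n
weight-mono {suc n} le = +-mono-≤ (*-monoˡ-≤ (2 ^ n) (le zero)) (weight-mono (le ∘ suc))

push-weight : ∀ {n a} b (R : Config n) → 2 ≤ a →
  weight (a ∸ 2 ∷ᶠ suc b ∷ᶠ R) ≤ weight (a ∷ᶠ b ∷ᶠ R)
push-weight {n} {suc (suc a)} b R (s≤s (s≤s _)) =
  ≤-trans (m≤m+n _ (3 * 2 ^ n)) (≤-reflexive (sym (rearrange a b (2 ^ n) (weight R))))
  where
  rearrange : ∀ a b P w →
    suc (suc a) * (2 * P) + (b * P + w) ≡ a * (2 * P) + (suc b * P + w) + 3 * P
  rearrange = solve-∀

pull-weight : ∀ {n} a {b} (R : Config n) → 2 ≤ b →
  weight (suc a ∷ᶠ b ∸ 2 ∷ᶠ R) ≡ weight (a ∷ᶠ b ∷ᶠ R)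
pull-weight {n} a {suc (suc b)} R (s≤s (s≤s _)) = rearrange a b (2 ^ n) (weight R)
  where
  rearrange : ∀ a b P w → suc a * (2 * P) + (b * P + w) ≡ a * (2 * P) + (suc (suc b) * P + w)
  rearrange = solve-∀

weight-move : ∀ {n} {C C′ : Config n} → Move C C′ → weight C′ ≤ weight C
weight-move (zero , zero , inj₁ () , _)
weight-move (zero , zero , inj₂ () , _)
weight-move (zero , suc (suc v) , inj₁ () , _)
weight-move (zero , suc v , inj₂ () , _)
weight-move (suc u , zero , inj₁ () , _)
weight-move (suc (suc u) , zero , inj₂ () , _)
weight-move {suc (suc n)} {C} {C′} (zero , suc zero , _ , 2≤ , eu , ev , rest) =
  ≤-trans (≤-reflexive (weight-cong after)) (push-weight (C (suc zero)) (tail (tail C)) 2≤)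
  where
  after : C′ ≗ (head C ∸ 2 ∷ᶠ suc (C (suc zero)) ∷ᶠ tail (tail C))
  after zero          = eu
  after (suc zero)    = ev
  after (suc (suc i)) = rest _ (λ ()) (λ ())
weight-move {suc (suc n)} {C} {C′} (suc zero , zero , _ , 2≤ , eu , ev , rest) =
  ≤-reflexive (trans (weight-cong after) (pull-weight (head C) (tail (tail C)) 2≤))
  where
  after : C′ ≗ (suc (head C) ∷ᶠ C (suc zero) ∸ 2 ∷ᶠ tail (tail C))
  after zero          = ev
  after (suc zero)    = eu
  after (suc (suc i)) = rest _ (λ ()) (λ ())
weight-move {suc n} {C} {C′} (suc u , suc v , adj , 2≤ , eu , ev , rest) =
  +-mono-≤ (≤-reflexive (cong (_* 2 ^ n) (rest zero (λ ()) (λ ()))))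
    (weight-move (u , v , Sum.map suc-injective suc-injective adj , 2≤ , eu , ev ,
      λ w w≢u w≢v → rest (suc w) (w≢u ∘ Finₚ.suc-injective) (w≢v ∘ Finₚ.suc-injective)))

weight-reach : ∀ {n} {C C′ : Config n} → Reach C C′ → weight C′ ≤ weight C
weight-reach ε       = ≤-refl
weight-reach (m ◅ r) = ≤-trans (weight-reach r) (weight-move m)

indicator : ∀ {n} → Subset n → Config n
indicator S = demand ∘ lookup S

indicator-≤ : ∀ {n} (S : Subset n) {C : Config n} → Covers S C → ∀ i → indicator S i ≤ C i
indicator-≤ (inside  ∷ S) cov zero    = cov zero here
indicator-≤ (outside ∷ S) cov zero    = z≤n
indicator-≤ (x ∷ S)       cov (suc i) = indicator-≤ S (λ v v∈S → cov (suc v) (there v∈S)) i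

front : ∀ n → ℕ → Subset n
front zero    t       = []
front (suc n) zero    = outside ∷ front n zero
front (suc n) (suc t) = inside ∷ front n t

∣front∣ : ∀ {n t} → t ≤ n → ∣ front n t ∣ ≡ t
∣front∣ {zero}  z≤n       = refl
∣front∣ {suc n} z≤n       = ∣front∣ {n} z≤n
∣front∣ {suc n} (s≤s t≤n) = cong suc (∣front∣ t≤n)

weight-front : ∀ n t → weight (indicator (front n t)) ≡ π n t
weight-front zero    t       = refl
weight-front (suc n) zero    = trans (weight-front n zero) (π-zeroʳ n)
weight-front (suc n) (suc t) = cong₂ _+_ (*-identityˡ (2 ^ n)) (weight-front n t)

pile : ∀ n → ℕ → Config (suc n)
pile zero    k = k ∷ᶠ []ᶠ
pile (suc n) k = 0 ∷ᶠ pile n k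

size-pile : ∀ n k → size (pile n k) ≡ k
size-pile zero    k = +-identityʳ k
size-pile (suc n) k = size-pile n k

weight-pile : ∀ n k → weight (pile n k) ≡ k
weight-pile zero    k = trans (+-identityʳ _) (*-identityʳ k)
weight-pile (suc n) k = weight-pile n k

¬allSolvable-<π : ∀ {n t k} → t ≤ n → k < π n t → ¬ AllSolvable n t k
¬allSolvable-<π {suc n} {t} {k} t≤n k<π solvable
  with solvable (pile n k) (size-pile n k) (front (suc n) t) (∣front∣ t≤n)
... | C′ , r , cov = <⇒≱ k<π (begin
  π (suc n) t                          ≡⟨ weight-front (suc n) t ⟨
  weight (indicator (front (suc n) t)) ≤⟨ weight-mono (indicator-≤ _ cov) ⟩
  weight C′                            ≤⟨ weight-reach r ⟩
  weight (pile n k)                    ≡⟨ weight-pile n k ⟩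
  k                                    ∎)
  where open ≤-Reasoning

isPebblingNumber-π : ∀ {n t} → t ≤ n → IsPebblingNumber n t (π n t)
isPebblingNumber-π t≤n = allSolvable-π _ _ , λ _ k<π → ¬allSolvable-<π t≤n k<π

theorem17 : (t n : ℕ) → 1 ≤ t → suc t ≤ n →
    ∃[ a ] ∃[ b ] (IsPebblingNumber n (suc t) a × IsPebblingNumber n t b
      × a * (2 * (2 ^ t ∸ 1)) ≡ b * (2 ^ suc t ∸ 1))
theorem17 t n _ t<n =
  π n (suc t) , π n t , isPebblingNumber-π t<n , isPebblingNumber-π (<⇒≤ t<n) , π-ratio t<n
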